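{- Let $d\ge 0$ and $\alpha=(m;p;z)\in\mathcal{I}(d)$. Then $P(\alpha)=\{(m';p';z')\in\mathcal{I}'(d): m'+p'\ge m \text{ and } m'\le m-z\}\subseteq\mathcal{I}'(d)$.
   Context: $\mathcal{S}_n=\{(m;p;z): m,p,z \text{ integers},\ 0\le z\le m\le n,\ 0\le p\le n\}$. For distinct $(m';p';z'),(m;p;z)\in\mathcal{S}_n$, $(m';p';z')\rightarrow(m;p;z)$ means there exist integers $e_0,e_1\ge 0$ with $e_0+e_1\le p'$ such that $m=m'+e_0+e_1$, $z=e_1$, $p=z'+2(p'-e_0-e_1)$. $P(\alpha)=\{\alpha'\in\mathcal{S}_n:\alpha'\rightarrow\alpha\}$. For $d\ge0$: $\mathcal{I}(d)=\{(m;p;z)\in\mathcal{S}_n: 2m+p=d\}$ and $\mathcal{I}'(d)=\{(m';p';z')\in\mathcal{S}_n: 2m'+2p'+z'=d \text{ and } (p',z')\neq(0,0)\}$. -}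

module Defs where

open import Data.Nat using (ℕ; _+_; _*_; _∸_; _≤_)
open import Data.Product using (_×_; Σ-syntax; ∃-syntax)
open import Relation.Binary.PropositionalEquality using (_≡_; _≢_)
open import Relation.Nullary using (¬_)

record Triple : Set where
  constructor ⟨_⨾_⨾_⟩
  field
    m p z : ℕ
open Triple public

InS : ℕ → Triple → Set
InS n t = (z t ≤ m t) × (m t ≤ n) × (p t ≤ n)

Arrow : ℕ → Triple → Triple → Set
Arrow n α' α =
  InS n α' × InS n α × (α' ≢ α) ×
  (∃[ e0 ] ∃[ e1 ]
     (e0 + e1 ≤ p α') ×
     (m α ≡ m α' + e0 + e1) ×
     (z α ≡ e1) ×
     (p α ≡ z α' + 2 * (p α' ∸ (e0 + e1))))

InP : ℕ → Triple → Triple → Set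
InP n α α' = Arrow n α' α

InI : ℕ → ℕ → Triple → Set
InI n d t = InS n t × (2 * m t + p t ≡ d)

InI' : ℕ → ℕ → Triple → Set
InI' n d t = InS n t × (2 * m t + 2 * p t + z t ≡ d) × ¬ ((p t ≡ 0) × (z t ≡ 0))

module Submission where

open import Defs
open import Data.Nat using (ℕ; zero; _+_; _*_; _∸_; _≤_; z≤n)
open import Data.Nat.Properties
open import Data.Nat.Tactic.RingSolver using (solve-∀)
open import Data.Product using (_×_; _,_; proj₁; ∃-syntax)
open import Function.Bundles using (_⇔_; mk⇔; Equivalence)
open import Relation.Binary.PropositionalEquality

-- An arrow α' → α moves e = e₀ + e₁ units of p' into m and is thus weight-preserving:
-- 2 m + p = 2 m' + 2 p' + z'. Conversely, the weight equation determines p, so an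
-- arrow exists as soon as the bounds on m allow e₁ = z and e₀ = m − z − m'.
-- Distinctness is then exactly the condition (p', z') ≠ (0, 0): a fixed weight
-- 2 m + p = 2 m + 2 p + z forces p = z = 0.

Step : Triple → Triple → Set
Step α' α =
  ∃[ e0 ] ∃[ e1 ]
    (e0 + e1 ≤ p α') ×
    (m α ≡ m α' + e0 + e1) ×
    (z α ≡ e1) ×
    (p α ≡ z α' + 2 * (p α' ∸ (e0 + e1)))

regroup-jump : ∀ m' e k z' → 2 * m' + 2 * (e + k) + z' ≡ 2 * (m' + e) + (z' + 2 * k)
regroup-jump = solve-∀

regroup-fixed : ∀ m p z → 2 * m + 2 * p + z ≡ 2 * m + p + (p + z)
regroup-fixed = solve-∀

weight-jump⇔ : ∀ m' p' z' e p → e ≤ p' →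
  (2 * (m' + e) + p ≡ 2 * m' + 2 * p' + z') ⇔ (p ≡ z' + 2 * (p' ∸ e))
weight-jump⇔ m' p' z' e p e≤p' with m≤n⇒∃[o]m+o≡n e≤p'
... | k , refl rewrite m+n∸m≡n e k = mk⇔
  (λ eq → +-cancelˡ-≡ (2 * (m' + e)) p (z' + 2 * k) (trans eq (regroup-jump m' e k z')))
  (λ { refl → sym (regroup-jump m' e k z') })

step-weight : ∀ {α' α} → Step α' α → 2 * m α + p α ≡ 2 * m α' + 2 * p α' + z α'
step-weight {⟨ m' ⨾ p' ⨾ z' ⟩} (e0 , e1 , e≤p' , refl , refl , refl) =
  trans (cong (λ x → 2 * x + (z' + 2 * (p' ∸ (e0 + e1)))) (+-assoc m' e0 e1))
        (Equivalence.from (weight-jump⇔ m' p' z' (e0 + e1) _ e≤p') refl)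

step-m≤m'+p' : ∀ {α' α} → Step α' α → m α ≤ m α' + p α'
step-m≤m'+p' {⟨ m' ⨾ p' ⨾ _ ⟩} (e0 , e1 , e≤p' , refl , _ , _) =
  subst (_≤ m' + p') (sym (+-assoc m' e0 e1)) (+-monoʳ-≤ m' e≤p')

step-m'≤m∸z : ∀ {α' α} → Step α' α → m α' ≤ m α ∸ z α
step-m'≤m∸z {⟨ m' ⨾ _ ⨾ _ ⟩} (e0 , e1 , _ , refl , refl , _) =
  subst (m' ≤_) (sym (m+n∸n≡m (m' + e0) e1)) (m≤m+n m' e0)

step-from-zero : ∀ {α' α} → Step α' α → p α' ≡ 0 → z α' ≡ 0 → α' ≡ α
step-from-zero {⟨ m' ⨾ .0 ⨾ .0 ⟩} {⟨ _ ⨾ _ ⨾ _ ⟩} (zero , zero , z≤n , refl , refl , refl) refl refl =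
  cong (λ x → ⟨ x ⨾ 0 ⨾ 0 ⟩) (sym (trans (+-identityʳ (m' + 0)) (+-identityʳ m')))

step-intro : ∀ {α' α} → z α ≤ m α → m α' ≤ m α ∸ z α → m α ≤ m α' + p α' →
  2 * m α + p α ≡ 2 * m α' + 2 * p α' + z α' → Step α' α
step-intro {⟨ m' ⨾ p' ⨾ z' ⟩} {⟨ m ⨾ p ⨾ z ⟩} z≤m m'≤m∸z m≤m'+p' weight
  with m≤n⇒∃[o]m+o≡n m'≤m∸z
... | a , m'+a≡m∸z = a , z , a+z≤p' , m≡m'+a+z , refl ,
  Equivalence.to (weight-jump⇔ m' p' z' (a + z) p a+z≤p')
    (subst (λ x → 2 * x + p ≡ _) (trans m≡m'+a+z (+-assoc m' a z)) weight)
  where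
  m≡m'+a+z : m ≡ m' + a + z
  m≡m'+a+z = trans (sym (m∸n+n≡m z≤m)) (cong (_+ z) (sym m'+a≡m∸z))
  a+z≤p' : a + z ≤ p'
  a+z≤p' = +-cancelˡ-≤ m' (a + z) p'
    (subst (_≤ m' + p') (trans m≡m'+a+z (+-assoc m' a z)) m≤m'+p')

weight-fixed⇒p≡0×z≡0 : ∀ m p z → 2 * m + p ≡ 2 * m + 2 * p + z → p ≡ 0 × z ≡ 0
weight-fixed⇒p≡0×z≡0 m p z eq = m+n≡0⇒m≡0 p p+z≡0 , m+n≡0⇒n≡0 p p+z≡0
  where
  p+z≡0 : p + z ≡ 0
  p+z≡0 = sym (+-cancelˡ-≡ (2 * m + p) 0 (p + z) (trans (+-identityʳ _) (trans eq (regroup-fixed m p z))))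

corollary1 : (n d : ℕ) (α : Triple) → InI n d α →
    ((α' : Triple) → InP n α α' ⇔ (InI' n d α' × (m α ≤ m α' + p α') × (m α' ≤ m α ∸ z α)))
    × ((α' : Triple) → InI' n d α' × (m α ≤ m α' + p α') × (m α' ≤ m α ∸ z α) → InI' n d α')
corollary1 n d α (α∈S , refl) = (λ α' → mk⇔ (arrow⇒bounds α') (bounds⇒arrow α')) , (λ _ → proj₁)
  where
  arrow⇒bounds : ∀ α' → InP n α α' →
    InI' n d α' × (m α ≤ m α' + p α') × (m α' ≤ m α ∸ z α)
  arrow⇒bounds α' (α'∈S , _ , α'≢α , step) =
    (α'∈S , sym (step-weight {α'} {α} step) ,
     λ (p≡0 , z≡0) → α'≢α (step-from-zero {α'} {α} step p≡0 z≡0)) ,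
    step-m≤m'+p' {α'} {α} step , step-m'≤m∸z {α'} {α} step

  bounds⇒arrow : ∀ α' → InI' n d α' × (m α ≤ m α' + p α') × (m α' ≤ m α ∸ z α) → InP n α α'
  bounds⇒arrow α' ((α'∈S , weight , nonzero) , m≤m'+p' , m'≤m∸z) =
    α'∈S , α∈S , α'≢α , step-intro {α'} {α} (proj₁ α∈S) m'≤m∸z m≤m'+p' (sym weight)
    where
    α'≢α : α' ≢ α
    α'≢α refl = nonzero (weight-fixed⇒p≡0×z≡0 (m α) (p α) (z α) (sym weight))
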